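{- Let $\alpha\neq 0$ and $a$ be complex numbers with $a\notin\{0,-\alpha,-2\alpha,\ldots\}$. For integers $n\ge 0$ and $k\in\mathbb{Z}$, the two-parameter Hurwitz-Lerch type poly-Bernoulli numbers satisfy $$B_n^{(k)}(\alpha,a)=(-1)^n\sum_{m=0}^{n}\frac{(-1)^m\, m!}{(\alpha m+a)^k}\left\{{n\atop m}\right\}.$$
   Context: The two-parameter Hurwitz-Lerch zeta function is $\Phi(z,s,\alpha,a)=\sum_{n=0}^{\infty}\frac{z^n}{(\alpha n+a)^s}$. The numbers $B_n^{(k)}(\alpha,a)$ are defined by the (formal power series) generating function $\Phi(1-e^{ -t},k,\alpha,a)=\sum_{m=0}^\infty\frac{(1-e^{ -t})^m}{(\alpha m+a)^k}=\sum_{n=0}^{\infty}B_n^{(k)}(\alpha,a)\frac{t^n}{n!}$. Here $\left\{{n\atop m}\right\}$ denotes the Stirling numbers of the second kind, defined by $\frac{(e^t-1)^m}{m!}=\sum_{n=0}^\infty \left\{{n\atop m}\right\}\frac{t^n}{n!}$. -}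

module Defs where

open import Level using (Level)
open import Algebra.Bundles using (CommutativeRing)
open import Data.Nat as ℕ using (ℕ; zero; suc; _∸_)
open import Data.Nat.Combinatorics using (_C_)
open import Data.Integer using (ℤ; +_; -[1+_])

-- Stirling numbers of the second kind {n over m}, via the standard recurrence
-- {0,0}=1, {n+1,0}=0, {0,m+1}=0, {n+1,m+1} = (m+1){n,m+1} + {n,m}
-- (equivalent to the EGF definition (e^t-1)^m/m! = Σ {n,m} t^n/n!).
stirling2 : ℕ → ℕ → ℕ
stirling2 zero    zero    = 1
stirling2 zero    (suc m) = 0
stirling2 (suc n) zero    = 0
stirling2 (suc n) (suc m) = suc m ℕ.* stirling2 n (suc m) ℕ.+ stirling2 n m

fact : ℕ → ℕ
fact zero    = 1
fact (suc n) = suc n ℕ.* fact n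

module _ {c ℓ : Level} (R : CommutativeRing c ℓ) where
  open CommutativeRing R

  fromℕ : ℕ → Carrier
  fromℕ zero    = 0#
  fromℕ (suc n) = 1# + fromℕ n

  pow : Carrier → ℕ → Carrier
  pow x zero    = 1#
  pow x (suc n) = x * pow x n

  sgn : ℕ → Carrier
  sgn n = pow (- 1#) n

  sumTo : ℕ → (ℕ → Carrier) → Carrier
  sumTo zero    f = f 0
  sumTo (suc n) f = sumTo n f + f (suc n)

  -- 1 / x^k for k ∈ ℤ, where xinv is an inverse of x:
  -- k = +n  ↦ xinv^n ;  k = -(n+1) ↦ x^(n+1)
  invPowℤ : Carrier → Carrier → ℤ → Carrier
  invPowℤ x xinv (+ n)      = pow xinv n
  invPowℤ x xinv -[1+ n ]   = pow x (suc n)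

  -- Exponential-generating-function coefficients: a formal power series
  -- Σ c_n t^n / n! is represented by n ↦ c_n; products are binomial convolutions.
  egfMul : (ℕ → Carrier) → (ℕ → Carrier) → (ℕ → Carrier)
  egfMul f g n = sumTo n (λ j → fromℕ (n C j) * (f j * g (n ∸ j)))

  egfOne : ℕ → Carrier
  egfOne zero    = 1#
  egfOne (suc n) = 0#

  -- 1 - e^{-t} : coefficient 0 at n = 0, and -(-1)^n for n ≥ 1
  oneMinusExpNeg : ℕ → Carrier
  oneMinusExpNeg zero    = 0#
  oneMinusExpNeg (suc n) = - sgn (suc n)

  egfPow : (ℕ → Carrier) → ℕ → (ℕ → Carrier)
  egfPow f zero    = egfOne
  egfPow f (suc m) = egfMul f (egfPow f m)

  -- B_n^{(k)}(α,a) = n! [t^n] Σ_{m≥0} (1-e^{-t})^m / (α m + a)^k.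
  -- Since (1-e^{-t})^m = O(t^m), only m ≤ n contribute to the t^n coefficient.
  -- inv m is the (given) inverse of α m + a.
  hlPolyBernoulli : (α a : Carrier) (inv : ℕ → Carrier) → ℕ → ℤ → Carrier
  hlPolyBernoulli α a inv n k =
    sumTo n (λ m → invPowℤ (α * fromℕ m + a) (inv m) k * egfPow oneMinusExpNeg m n)

{-# OPTIONS --safe #-}
-- Write F = 1 - e^{-t} and E_m(n) for the n-th EGF coefficient of F^m. Since F' = 1 - F,
-- the Leibniz rule gives (F^{m+1})' = (m+1)(F^m - F^{m+1}), that is
-- E_{m+1}(n+1) = (m+1)(E_m(n) - E_{m+1}(n)). Multiplying the Stirling recurrence by
-- (-1)^{n+m} m! shows that (-1)^{n+m} m! {n over m} satisfies the same recurrence with the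
-- same boundary values, so the two agree; substituting into the defining sum of
-- B_n^{(k)}(α,a) gives the formula.
module Submission where

open import Defs
open import Level using (Level)
open import Algebra.Bundles using (CommutativeRing)
open import Data.Nat as ℕ using (ℕ; zero; suc; _∸_; _≤_; z≤n)
open import Data.Integer using (ℤ)
open import Relation.Nullary using (¬_)
open import Data.Nat.Properties using (m≤n⇒m≤1+n; ≤-refl; +-∸-assoc; n<1+n)
open import Data.Nat.Combinatorics using (_C_; nCk+nC[k+1]≡[n+1]C[k+1]; k>n⇒nCk≡0)
import Relation.Binary.PropositionalEquality as ≡

module _ {c ℓ : Level} (R : CommutativeRing c ℓ) where
  open CommutativeRing R
  open import Relation.Binary.Reasoning.Setoid setoid
  open import Algebra.Definitions.RawMonoid +-rawMonoid using (_×_)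
  open import Algebra.Properties.Monoid.Mult +-monoid using (×-homo-+)
  open import Algebra.Properties.Semiring.Mult semiring using (×1-homo-*)
  open import Algebra.Properties.CommutativeSemigroup +-commutativeSemigroup
    using (interchange; x∙yz≈y∙xz)
  open import Algebra.Properties.AbelianGroup +-abelianGroup using (⁻¹-∙-comm)
  open import Algebra.Properties.Group +-group using (⁻¹-involutive; ε⁻¹≈ε)
  open import Algebra.Properties.Ring ring
    using (-1*x≈-x; -‿distribˡ-*; -‿distribʳ-*; x[y-z]≈xy-xz; [y-z]x≈yx-zx)
  open import Algebra.Solver.Ring.NaturalCoefficients.Default commutativeSemiring
    using (solve; _:+_; _:*_; _:=_)

  ∑ : ℕ → (ℕ → Carrier) → Carrier
  ∑ = sumTo R

  ι : ℕ → Carrier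
  ι = fromℕ R

  sumTo-cong : ∀ n {f g : ℕ → Carrier} → (∀ i → i ≤ n → f i ≈ g i) → ∑ n f ≈ ∑ n g
  sumTo-cong zero    f≈g = f≈g 0 z≤n
  sumTo-cong (suc n) f≈g =
    +-cong (sumTo-cong n (λ i i≤n → f≈g i (m≤n⇒m≤1+n i≤n))) (f≈g (suc n) ≤-refl)

  sumTo-homo-+ : ∀ n (f g : ℕ → Carrier) → ∑ n (λ i → f i + g i) ≈ ∑ n f + ∑ n g
  sumTo-homo-+ zero    f g = refl
  sumTo-homo-+ (suc n) f g =
    trans (+-congʳ (sumTo-homo-+ n f g)) (interchange _ _ _ _)

  sumTo-homo-- : ∀ n (f g : ℕ → Carrier) → ∑ n (λ i → f i - g i) ≈ ∑ n f - ∑ n g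
  sumTo-homo-- zero    f g = refl
  sumTo-homo-- (suc n) f g = begin
    ∑ n (λ i → f i - g i) + (f (suc n) - g (suc n))
      ≈⟨ +-congʳ (sumTo-homo-- n f g) ⟩
    (∑ n f - ∑ n g) + (f (suc n) - g (suc n))
      ≈⟨ interchange _ _ _ _ ⟩
    (∑ n f + f (suc n)) + (- ∑ n g + - g (suc n))
      ≈⟨ +-congˡ (⁻¹-∙-comm _ _) ⟩
    (∑ n f + f (suc n)) - (∑ n g + g (suc n)) ∎

  sumTo-distribˡ : ∀ n x (f : ℕ → Carrier) → ∑ n (λ i → x * f i) ≈ x * ∑ n f
  sumTo-distribˡ zero    x f = refl
  sumTo-distribˡ (suc n) x f =
    trans (+-congʳ (sumTo-distribˡ n x f)) (sym (distribˡ x _ _))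

  sumTo-zero : ∀ n (f : ℕ → Carrier) → (∀ i → f i ≈ 0#) → ∑ n f ≈ 0#
  sumTo-zero zero    f f≈0 = f≈0 0
  sumTo-zero (suc n) f f≈0 =
    trans (+-cong (sumTo-zero n f f≈0) (f≈0 (suc n))) (+-identityˡ 0#)

  sumTo-suc-shift : ∀ n (f : ℕ → Carrier) → ∑ (suc n) f ≈ f 0 + ∑ n (λ i → f (suc i))
  sumTo-suc-shift zero    f = refl
  sumTo-suc-shift (suc n) f =
    trans (+-congʳ (sumTo-suc-shift n f)) (+-assoc _ _ _)

  sumTo-suc-dropLast : ∀ n (f : ℕ → Carrier) → f (suc n) ≈ 0# → ∑ (suc n) f ≈ ∑ n f
  sumTo-suc-dropLast n f f[n+1]≈0 = trans (+-congˡ f[n+1]≈0) (+-identityʳ _)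

  ι≈×1 : ∀ n → ι n ≈ n × 1#
  ι≈×1 zero    = refl
  ι≈×1 (suc n) = +-congˡ (ι≈×1 n)

  ι-homo-+ : ∀ m n → ι (m ℕ.+ n) ≈ ι m + ι n
  ι-homo-+ m n = begin
    ι (m ℕ.+ n)        ≈⟨ ι≈×1 (m ℕ.+ n) ⟩
    (m ℕ.+ n) × 1#     ≈⟨ ×-homo-+ 1# m n ⟩
    m × 1# + n × 1#           ≈⟨ +-cong (ι≈×1 m) (ι≈×1 n) ⟨
    ι m + ι n                 ∎

  ι-homo-* : ∀ m n → ι (m ℕ.* n) ≈ ι m * ι n
  ι-homo-* m n = begin
    ι (m ℕ.* n)        ≈⟨ ι≈×1 (m ℕ.* n) ⟩
    (m ℕ.* n) × 1#     ≈⟨ ×1-homo-* m n ⟩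
    m × 1# * n × 1#           ≈⟨ *-cong (ι≈×1 m) (ι≈×1 n) ⟨
    ι m * ι n                 ∎

  EGF : Set c
  EGF = ℕ → Carrier

  infix  4 _≐_
  infixl 7 _⊛_
  infixr 7 _·_
  infixl 6 _⊕_ _⊖_

  _≐_ : EGF → EGF → Set ℓ
  f ≐ g = ∀ n → f n ≈ g n

  _⊛_ : EGF → EGF → EGF
  _⊛_ = egfMul R

  _⊕_ : EGF → EGF → EGF
  (f ⊕ g) n = f n + g n

  _⊖_ : EGF → EGF → EGF
  (f ⊖ g) n = f n - g n

  _·_ : Carrier → EGF → EGF
  (x · f) n = x * f n

  ∂ : EGF → EGF
  ∂ f n = f (suc n)

  ⊛-congˡ : ∀ {f g} h → f ≐ g → f ⊛ h ≐ g ⊛ h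
  ⊛-congˡ h f≐g n = sumTo-cong n (λ j _ → *-congˡ (*-congʳ (f≐g j)))

  ⊛-congʳ : ∀ f {g h} → g ≐ h → f ⊛ g ≐ f ⊛ h
  ⊛-congʳ f g≐h n = sumTo-cong n (λ j _ → *-congˡ (*-congˡ (g≐h (n ∸ j))))

  ι1*[1*x]≈x : ∀ x → ι 1 * (1# * x) ≈ x
  ι1*[1*x]≈x x = trans (*-cong (+-identityʳ 1#) (*-identityˡ x)) (*-identityˡ x)

  ⊛-identityˡ : ∀ f → egfOne R ⊛ f ≐ f
  ⊛-identityˡ f zero    = ι1*[1*x]≈x (f 0)
  ⊛-identityˡ f (suc n) = begin
    (egfOne R ⊛ f) (suc n)
      ≈⟨ sumTo-suc-shift n _ ⟩
    ι 1 * (1# * f (suc n)) + ∑ n (λ j → ι (suc n C suc j) * (0# * f (n ∸ j)))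
      ≈⟨ +-cong (ι1*[1*x]≈x (f (suc n)))
                (sumTo-zero n _ (λ j → trans (*-congˡ (zeroˡ _)) (zeroʳ _))) ⟩
    f (suc n) + 0#
      ≈⟨ +-identityʳ _ ⟩
    f (suc n) ∎

  ⊛-zeroʳ : ∀ f → f ⊛ (λ _ → 0#) ≐ (λ _ → 0#)
  ⊛-zeroʳ f n = sumTo-zero n _ (λ j → trans (*-congˡ (zeroʳ _)) (zeroʳ _))

  ⊛-distribʳ-⊖ : ∀ f g h → (f ⊖ g) ⊛ h ≐ f ⊛ h ⊖ g ⊛ h
  ⊛-distribʳ-⊖ f g h n = trans
    (sumTo-cong n (λ j _ → trans (*-congˡ ([y-z]x≈yx-zx _ _ _)) (x[y-z]≈xy-xz _ _ _)))
    (sumTo-homo-- n _ _)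

  ⊛-distribˡ-⊖ : ∀ f g h → f ⊛ (g ⊖ h) ≐ f ⊛ g ⊖ f ⊛ h
  ⊛-distribˡ-⊖ f g h n = trans
    (sumTo-cong n (λ j _ → trans (*-congˡ (x[y-z]≈xy-xz _ _ _)) (x[y-z]≈xy-xz _ _ _)))
    (sumTo-homo-- n _ _)

  ⊛-·-commʳ : ∀ f x g → f ⊛ (x · g) ≐ x · (f ⊛ g)
  ⊛-·-commʳ f x g n = trans
    (sumTo-cong n (λ j _ →
      solve 4 (λ b x u v → b :* (u :* (x :* v)) := x :* (b :* (u :* v))) refl _ x _ _))
    (sumTo-distribˡ n x _)

  ⊛-∂ʳ-shift : ∀ f g n →
    (f ⊛ ∂ g) n ≈ ι (n C 0) * (f 0 * g (suc n))
                  + ∑ n (λ j → ι (n C suc j) * (f (suc j) * g (n ∸ j)))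
  ⊛-∂ʳ-shift f g n = begin
    ∑ n (λ j → ι (n C j) * (f j * g (suc (n ∸ j))))
      ≈⟨ sumTo-cong n (λ j j≤n → reflexive
           (≡.cong (λ i → ι (n C j) * (f j * g i)) (≡.sym (+-∸-assoc 1 j≤n)))) ⟩
    ∑ n (λ j → ι (n C j) * (f j * g (suc n ∸ j)))
      ≈⟨ sumTo-suc-dropLast n _ (trans (*-congʳ (reflexive (≡.cong ι (k>n⇒nCk≡0 (n<1+n n)))))
                                       (zeroˡ _)) ⟨
    ∑ (suc n) (λ j → ι (n C j) * (f j * g (suc n ∸ j)))
      ≈⟨ sumTo-suc-shift n _ ⟩
    ι (n C 0) * (f 0 * g (suc n)) + ∑ n (λ j → ι (n C suc j) * (f (suc j) * g (n ∸ j))) ∎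

  ∂-⊛ : ∀ f g → ∂ (f ⊛ g) ≐ ∂ f ⊛ g ⊕ f ⊛ ∂ g
  ∂-⊛ f g n = begin
    (f ⊛ g) (suc n)
      ≈⟨ sumTo-suc-shift n _ ⟩
    head + ∑ n (λ j → ι (suc n C suc j) * X j)
      ≈⟨ +-congˡ (trans (sumTo-cong n (λ j _ → pascal j)) (sumTo-homo-+ n _ _)) ⟩
    head + ((∂ f ⊛ g) n + ∑ n (λ j → ι (n C suc j) * X j))
      ≈⟨ x∙yz≈y∙xz _ _ _ ⟩
    (∂ f ⊛ g) n + (head + ∑ n (λ j → ι (n C suc j) * X j))
      ≈⟨ +-congˡ (⊛-∂ʳ-shift f g n) ⟨
    (∂ f ⊛ g) n + (f ⊛ ∂ g) n ∎
    where
    head : Carrier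
    head = ι (suc n C 0) * (f 0 * g (suc n))
    X : ℕ → Carrier
    X j = f (suc j) * g (n ∸ j)
    pascal : ∀ j → ι (suc n C suc j) * X j ≈ ι (n C j) * X j + ι (n C suc j) * X j
    pascal j = begin
      ι (suc n C suc j) * X j
        ≈⟨ *-congʳ (reflexive (≡.cong ι (nCk+nC[k+1]≡[n+1]C[k+1] n j))) ⟨
      ι (n C j ℕ.+ n C suc j) * X j
        ≈⟨ *-congʳ (ι-homo-+ (n C j) (n C suc j)) ⟩
      (ι (n C j) + ι (n C suc j)) * X j
        ≈⟨ distribʳ _ _ _ ⟩
      ι (n C j) * X j + ι (n C suc j) * X j ∎

  ∂-oneMinusExpNeg : ∂ (oneMinusExpNeg R) ≐ egfOne R ⊖ oneMinusExpNeg R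
  ∂-oneMinusExpNeg zero = begin
    - (- 1# * 1#) ≈⟨ -‿cong (*-identityʳ _) ⟩
    - (- 1#)      ≈⟨ ⁻¹-involutive _ ⟩
    1#            ≈⟨ +-identityʳ _ ⟨
    1# + 0#       ≈⟨ +-congˡ ε⁻¹≈ε ⟨
    1# - 0#       ∎
  ∂-oneMinusExpNeg (suc n) = trans (-‿cong (-1*x≈-x _)) (sym (+-identityˡ _))

  module _ {f : EGF} (∂f≐1-f : ∂ f ≐ egfOne R ⊖ f) where

    private
      E : ℕ → EGF
      E = egfPow R f

    ∂-egfPow-suc-step : ∀ m → f ⊛ ∂ (E m) ≐ ι m · (E m ⊖ E (suc m)) →
                        ∂ (E (suc m)) ≐ ι (suc m) · (E m ⊖ E (suc m))
    ∂-egfPow-suc-step m f⊛∂Eₘ n = begin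
      ∂ (f ⊛ E m) n                  ≈⟨ ∂-⊛ f (E m) n ⟩
      (∂ f ⊛ E m) n + (f ⊛ ∂ (E m)) n ≈⟨ +-cong ∂f⊛Eₘ (f⊛∂Eₘ n) ⟩
      Δ + ι m * Δ                    ≈⟨ +-congʳ (*-identityˡ Δ) ⟨
      1# * Δ + ι m * Δ               ≈⟨ distribʳ Δ 1# (ι m) ⟨
      ι (suc m) * Δ                  ∎
      where
      Δ : Carrier
      Δ = E m n - E (suc m) n
      ∂f⊛Eₘ : (∂ f ⊛ E m) n ≈ Δ
      ∂f⊛Eₘ = begin
        (∂ f ⊛ E m) n                        ≈⟨ ⊛-congˡ (E m) ∂f≐1-f n ⟩
        ((egfOne R ⊖ f) ⊛ E m) n             ≈⟨ ⊛-distribʳ-⊖ (egfOne R) f (E m) n ⟩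
        (egfOne R ⊛ E m) n - (f ⊛ E m) n     ≈⟨ +-congʳ (⊛-identityˡ (E m) n) ⟩
        Δ                                    ∎

    ⊛-∂-egfPow : ∀ m → f ⊛ ∂ (E m) ≐ ι m · (E m ⊖ E (suc m))
    ⊛-∂-egfPow zero    n = trans (⊛-zeroʳ f n) (sym (zeroˡ _))
    ⊛-∂-egfPow (suc m) n = begin
      (f ⊛ ∂ (E (suc m))) n
        ≈⟨ ⊛-congʳ f (∂-egfPow-suc-step m (⊛-∂-egfPow m)) n ⟩
      (f ⊛ (ι (suc m) · (E m ⊖ E (suc m)))) n
        ≈⟨ ⊛-·-commʳ f (ι (suc m)) (E m ⊖ E (suc m)) n ⟩
      ι (suc m) * (f ⊛ (E m ⊖ E (suc m))) n
        ≈⟨ *-congˡ (⊛-distribˡ-⊖ f (E m) (E (suc m)) n) ⟩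
      ι (suc m) * (E (suc m) n - E (suc (suc m)) n) ∎

    ∂-egfPow-suc : ∀ m → ∂ (E (suc m)) ≐ ι (suc m) · (E m ⊖ E (suc m))
    ∂-egfPow-suc m = ∂-egfPow-suc-step m (⊛-∂-egfPow m)

  -x*-y≈x*y : ∀ x y → - x * - y ≈ x * y
  -x*-y≈x*y x y = begin
    - x * - y     ≈⟨ -‿distribˡ-* x (- y) ⟨
    - (x * - y)   ≈⟨ -‿cong (-‿distribʳ-* x y) ⟨
    - (- (x * y)) ≈⟨ ⁻¹-involutive _ ⟩
    x * y         ∎

  signedStirling : ℕ → ℕ → Carrier
  signedStirling n m = sgn R n * sgn R m * ι (fact m) * ι (stirling2 n m)

  signedStirling-suc-suc : ∀ n m →
    ι (suc m) * (signedStirling n m - signedStirling n (suc m)) ≈ signedStirling (suc n) (suc m)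
  signedStirling-suc-suc n m = begin
    K * (x * Fm * B - signedStirling n (suc m))
      ≈⟨ *-congˡ (+-congˡ (trans (-‿cong [n,m+1]) (⁻¹-involutive _))) ⟩
    K * (x * Fm * B + x * (K * Fm) * A)
      ≈⟨ solve 5 (λ K x Fm A B → K :* (x :* Fm :* B :+ x :* (K :* Fm) :* A)
                                 := x :* (K :* Fm) :* (K :* A :+ B)) refl K x Fm A B ⟩
    x * (K * Fm) * (K * A + B)
      ≈⟨ [n+1,m+1] ⟨
    signedStirling (suc n) (suc m) ∎
    where
    K x Fm A B : Carrier
    K  = ι (suc m)
    x  = sgn R n * sgn R m
    Fm = ι (fact m)
    A  = ι (stirling2 n (suc m))
    B  = ι (stirling2 n m)
    [n,m+1] : signedStirling n (suc m) ≈ - (x * (K * Fm) * A)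
    [n,m+1] = begin
      sgn R n * (- 1# * sgn R m) * ι (suc m ℕ.* fact m) * A
        ≈⟨ *-congʳ (*-cong (trans (*-congˡ (-1*x≈-x _)) (sym (-‿distribʳ-* _ _)))
                           (ι-homo-* (suc m) (fact m))) ⟩
      - x * (K * Fm) * A   ≈⟨ *-congʳ (-‿distribˡ-* x (K * Fm)) ⟨
      - (x * (K * Fm)) * A ≈⟨ -‿distribˡ-* _ A ⟨
      - (x * (K * Fm) * A) ∎
    [n+1,m+1] : signedStirling (suc n) (suc m) ≈ x * (K * Fm) * (K * A + B)
    [n+1,m+1] = *-cong
      (*-cong (trans (*-cong (-1*x≈-x _) (-1*x≈-x _)) (-x*-y≈x*y _ _)) (ι-homo-* (suc m) (fact m)))
      (trans (ι-homo-+ (suc m ℕ.* stirling2 n (suc m)) (stirling2 n m))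
             (+-congʳ (ι-homo-* (suc m) (stirling2 n (suc m)))))

  egfPow-oneMinusExpNeg : ∀ m n → egfPow R (oneMinusExpNeg R) m n ≈ signedStirling n m
  egfPow-oneMinusExpNeg zero    zero    = sym (begin
    1# * 1# * ι 1 * ι 1 ≈⟨ *-cong (*-cong (*-identityˡ 1#) (+-identityʳ 1#)) (+-identityʳ 1#) ⟩
    1# * 1# * 1#        ≈⟨ *-identityʳ _ ⟩
    1# * 1#             ≈⟨ *-identityʳ _ ⟩
    1#                  ∎)
  egfPow-oneMinusExpNeg zero    (suc n) = sym (zeroʳ _)
  egfPow-oneMinusExpNeg (suc m) zero    =
    trans (trans (*-congˡ (zeroˡ _)) (zeroʳ _)) (sym (zeroʳ _))
  egfPow-oneMinusExpNeg (suc m) (suc n) = begin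
    egfPow R F (suc m) (suc n)
      ≈⟨ ∂-egfPow-suc ∂-oneMinusExpNeg m n ⟩
    ι (suc m) * (egfPow R F m n - egfPow R F (suc m) n)
      ≈⟨ *-congˡ (+-cong (egfPow-oneMinusExpNeg m n) (-‿cong (egfPow-oneMinusExpNeg (suc m) n))) ⟩
    ι (suc m) * (signedStirling n m - signedStirling n (suc m))
      ≈⟨ signedStirling-suc-suc n m ⟩
    signedStirling (suc n) (suc m) ∎
    where
    F : EGF
    F = oneMinusExpNeg R

  weightedSum-egfPow-oneMinusExpNeg : ∀ n (w : ℕ → Carrier) →
    ∑ n (λ m → w m * egfPow R (oneMinusExpNeg R) m n)
      ≈ sgn R n * ∑ n (λ m → sgn R m * ι (fact m) * w m * ι (stirling2 n m))
  weightedSum-egfPow-oneMinusExpNeg n w = begin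
    ∑ n (λ m → w m * egfPow R (oneMinusExpNeg R) m n)
      ≈⟨ sumTo-cong n (λ m _ → *-congˡ (egfPow-oneMinusExpNeg m n)) ⟩
    ∑ n (λ m → w m * signedStirling n m)
      ≈⟨ sumTo-cong n (λ m _ → solve 5
           (λ w sn sm F S → w :* (sn :* sm :* F :* S) := sn :* (sm :* F :* w :* S))
           refl (w m) (sgn R n) (sgn R m) (ι (fact m)) (ι (stirling2 n m))) ⟩
    ∑ n (λ m → sgn R n * (sgn R m * ι (fact m) * w m * ι (stirling2 n m)))
      ≈⟨ sumTo-distribˡ n (sgn R n) _ ⟩
    sgn R n * ∑ n (λ m → sgn R m * ι (fact m) * w m * ι (stirling2 n m)) ∎

-- The formula holds term by term for any family inv.
theorem1 : {c ℓ : Level} (R : CommutativeRing c ℓ) →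
    let open CommutativeRing R in
    (α a : Carrier) → ¬ (α ≈ 0#) →
    (inv : ℕ → Carrier) →
    ((m : ℕ) → (α * fromℕ R m + a) * inv m ≈ 1#) →
    (n : ℕ) (k : ℤ) →
    hlPolyBernoulli R α a inv n k
      ≈ sgn R n * sumTo R n (λ m → sgn R m * fromℕ R (fact m)
                                   * invPowℤ R (α * fromℕ R m + a) (inv m) k
                                   * fromℕ R (stirling2 n m))
theorem1 R α a _ inv _ n k =
  weightedSum-egfPow-oneMinusExpNeg R n (λ m → invPowℤ R (α * fromℕ R m + a) (inv m) k)
  where open CommutativeRing R using (_+_; _*_)
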